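{- If an HDA $Q$ has non-repeating events, then it is consistent.
   Context: Precubical sets: families of disjoint sets $Q_n$ with face maps $s_k,t_k:Q_n\to Q_{n-1}$ ($k=1,\dots,n$) satisfying $\alpha_k\beta_\ell=\beta_{\ell-1}\alpha_k$ for $\alpha,\beta\in\{s,t\}$, $k<\ell$. An HDA is a finite precubical set with initial cell $I\in Q_0$, assumed connected (every cell is reachable from $I$ by a path of steps $q'\xrightarrow{s_i}q$ with $s_iq=q'$ or $q\xrightarrow{t_i}q'$ with $t_iq=q'$). Universal labels: $\approx$ is the equivalence on $Q_1$ generated by $(s_iq,t_iq)$ for $q\in Q_2$, $i\in\{1,2\}$; $\lambda(e)$ is the class of $e\in Q_1$. $Q$ is consistent if there is no $q\in Q_2$ with $s_1q\approx s_2q$. A sequential path is $v_0\xrightarrow{s}e_1\xrightarrow{t}v_1\cdots\xrightarrow{s}e_n\xrightarrow{t}v_n$ with $v_j\in Q_0$, $e_j\in Q_1$, $s_1(e_j)=v_{j-1}$, $t_1(e_j)=v_j$. $Q$ has non-repeating events if on every sequential path the labels $\lambda(e_1),\dots,\lambda(e_n)$ are pairwise distinct. -}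

module Defs where

open import Data.Nat using (ℕ; zero; suc; _≤_)
open import Data.Fin using (Fin; toℕ; inject₁)
open import Data.Product using (Σ; ∃; _,_; _×_)
open import Data.List using (List; []; _∷_)
open import Data.List.Relation.Unary.AllPairs using (AllPairs)
open import Relation.Nullary using (¬_)
open import Relation.Binary.PropositionalEquality using (_≡_)
open import Relation.Binary.Construct.Closure.ReflexiveTransitive using (Star)
open import Relation.Binary.Construct.Closure.Equivalence using (EqClosure)
open import Function.Bundles using (_↔_)

data Sgn : Set where
  s t : Sgn

-- Cell n = Q_n (disjointness is automatic by indexing).
-- face n α k : Q_{n+1} → Q_n is α_{k+1} (face indices are 0-based: k : Fin (n+1)
-- stands for the paper's index k+1 ∈ {1,…,n+1}).
-- Precubical identity: for paper indices k < ℓ, α_k β_ℓ = β_{ℓ-1} α_k.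
-- With 0-based k : Fin (n+1), ℓ = suc ℓ' (ℓ' : Fin (n+1)), k ≤ ℓ'.
record PrecubicalSet : Set₁ where
  field
    Cell : ℕ → Set
    face : (n : ℕ) → Sgn → Fin (suc n) → Cell (suc n) → Cell n
    cubical : ∀ (n : ℕ) (α β : Sgn) (k ℓ : Fin (suc n)) → toℕ k ≤ toℕ ℓ →
              (x : Cell (suc (suc n))) →
              face n α k (face (suc n) β (Fin.suc ℓ) x)
                ≡ face n β ℓ (face (suc n) α (inject₁ k) x)

  AnyCell : Set
  AnyCell = Σ ℕ Cell

  data Step : AnyCell → AnyCell → Set where
    up   : ∀ {n} (i : Fin (suc n)) (q : Cell (suc n)) →
           Step (n , face n s i q) (suc n , q)
    down : ∀ {n} (i : Fin (suc n)) (q : Cell (suc n)) →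
           Step (suc n , q) (n , face n t i q)

  s₁ : Cell 1 → Cell 0
  s₁ = face 0 s Fin.zero
  t₁ : Cell 1 → Cell 0
  t₁ = face 0 t Fin.zero

  data LabelGen : Cell 1 → Cell 1 → Set where
    gen : (q : Cell 2) (i : Fin 2) → LabelGen (face 1 s i q) (face 1 t i q)

  -- universal-label equivalence ≈ (equivalence closure); λ(e) is the ≈-class of e
  _≈_ : Cell 1 → Cell 1 → Set
  _≈_ = EqClosure LabelGen

  data SeqPath : Cell 0 → List (Cell 1) → Set where
    done : (v : Cell 0) → SeqPath v []
    step : (v : Cell 0) (e : Cell 1) {es : List (Cell 1)} →
           s₁ e ≡ v → SeqPath (t₁ e) es → SeqPath v (e ∷ es)

  NonRepeatingEvents : Set
  NonRepeatingEvents = ∀ (v : Cell 0) (es : List (Cell 1)) → SeqPath v es →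
                       AllPairs (λ e e′ → ¬ (e ≈ e′)) es

  Consistent : Set
  Consistent = ¬ (Σ (Cell 2) λ q → face 1 s Fin.zero q ≈ face 1 s (Fin.suc Fin.zero) q)

record HDA : Set₁ where
  field
    pc : PrecubicalSet
  open PrecubicalSet pc public
  field
    size      : ℕ → ℕ
    finite    : ∀ n → Cell n ↔ Fin (size n)
    dimBound  : ∃ λ N → ∀ n → N ≤ n → size n ≡ 0
    I         : Cell 0
    connected : ∀ (c : AnyCell) → Star Step (0 , I) c

module Submission where

-- Let q be a 2-cell of a precubical set.  Going from the
-- vertex s₁ s₂ q along the edge s₂ q and then along the edge t₁ q is a
-- sequential path of length two: the precubical identity t₁ s₂ = s₁ t₁ says
-- that the first edge ends where the second one begins.  The generating pair
-- (s₁ q , t₁ q) of the label equivalence gives s₁ q ≈ t₁ q.  Hence if q were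
-- inconsistent, i.e. s₁ q ≈ s₂ q, then s₂ q ≈ t₁ q, so this path would repeat
-- an event.
--
-- None of this uses finiteness, the initial cell or connectedness, so the
-- result is proved for arbitrary precubical sets first and the proposition
-- about HDAs is its instance for the underlying precubical set.

open import Defs
open import Data.Nat using (z≤n)
open import Data.Fin using (Fin)
open import Data.List using ([]; _∷_)
open import Data.List.Relation.Unary.All using (_∷_)
open import Data.List.Relation.Unary.AllPairs using (_∷_)
open import Data.Product using (_,_)
open import Relation.Nullary using (¬_)
open import Relation.Binary.PropositionalEquality using (refl; sym)
open import Relation.Binary.Construct.Closure.Equivalence using (symmetric; transitive; return)

module _ (P : PrecubicalSet) where
  open PrecubicalSet P

  s₁² s₂² t₁² : Cell 2 → Cell 1
  s₁² = face 1 s Fin.zero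
  s₂² = face 1 s (Fin.suc Fin.zero)
  t₁² = face 1 t Fin.zero

  -- The edges s₂ q and t₁ q form a sequential path starting at s₁ s₂ q;
  -- the junction is the precubical identity t₁ s₂ q = s₁ t₁ q.
  lowerRightPath : (q : Cell 2) → SeqPath (s₁ (s₂² q)) (s₂² q ∷ t₁² q ∷ [])
  lowerRightPath q =
    step _ (s₂² q) refl
      (step _ (t₁² q) (sym (cubical 0 t s Fin.zero Fin.zero z≤n q)) (done _))

  s₁≈t₁ : (q : Cell 2) → s₁² q ≈ t₁² q
  s₁≈t₁ q = return (gen q Fin.zero)

  distinctLabels : NonRepeatingEvents → ∀ {v e e′} →
                   SeqPath v (e ∷ e′ ∷ []) → ¬ (e ≈ e′)
  distinctLabels nre path with nre _ _ path
  ... | (e≉e′ ∷ _) ∷ _ = e≉e′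

  nonRepeating⇒consistent : NonRepeatingEvents → Consistent
  nonRepeating⇒consistent nre (q , s₁≈s₂) =
    distinctLabels nre (lowerRightPath q) s₂≈t₁
    where
    s₂≈t₁ : s₂² q ≈ t₁² q
    s₂≈t₁ = transitive LabelGen (symmetric LabelGen s₁≈s₂) (s₁≈t₁ q)

proposition4p3 : (Q : HDA) → HDA.NonRepeatingEvents Q → HDA.Consistent Q
proposition4p3 Q = nonRepeating⇒consistent (HDA.pc Q)
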